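{- Let $G=C_N$ be the cycle graph on $N\geq3$ nodes and let $t\in\{1,\ldots,N\}$. Then $\chi_t(C_N)=\gcd(t,N)$.
   Context: All graphs are finite, simple and connected. A path of length $t$ is a sequence $v_1,\ldots,v_{t+1}$ of distinct vertices with $v_j\sim v_{j+1}$ for all $j$; its endpoints are $v_1$ and $v_{t+1}$. A (not necessarily proper) colouring of the vertices of $G$ is $t$-periodic if every path of length $t$ in $G$ has endpoints of the same colour. The vertex $t$-periodic colouring number $\chi_t(G)$ is the largest $k$ such that $G$ has a $t$-periodic colouring of the vertices using exactly $k$ colours. -}

module Defs where

open import Data.Nat using (ℕ; zero; suc; _∸_)
open import Data.Fin using (Fin; toℕ; inject₁; fromℕ)
import Data.Fin as F
open import Data.Product using (Σ; _×_; ∃)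
open import Data.Sum using (_⊎_)
open import Function.Definitions using (Injective; Surjective)
open import Relation.Binary.PropositionalEquality using (_≡_)

record Path {V : Set} (Adj : V → V → Set) (t : ℕ) : Set where
  field
    vtx      : Fin (suc t) → V
    distinct : Injective _≡_ _≡_ vtx
    adjacent : (j : Fin t) → Adj (vtx (inject₁ j)) (vtx (F.suc j))

open Path public

start : ∀ {V} {Adj : V → V → Set} {t} → Path Adj t → V
start p = vtx p F.zero

end : ∀ {V} {Adj : V → V → Set} {t} → Path Adj t → V
end {t = t} p = vtx p (fromℕ t)

Periodic : ∀ {V C : Set} (Adj : V → V → Set) (t : ℕ) (c : V → C) → Set
Periodic Adj t c = (p : Path Adj t) → c (start p) ≡ c (end p)

-- A t-periodic colouring using exactly k colours: a surjection onto Fin k.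
HasPeriodicColouring : ∀ {V : Set} (Adj : V → V → Set) (t k : ℕ) → Set
HasPeriodicColouring {V} Adj t k =
  Σ (V → Fin k) λ c → Surjective _≡_ _≡_ c × Periodic Adj t c

-- Cycle graph C_N on vertices 0,…,N-1: i ~ j iff j = i+1 or i = j+1 (mod N).
CycleSucc : (N : ℕ) → Fin N → Fin N → Set
CycleSucc N i j = (toℕ j ≡ suc (toℕ i)) ⊎ ((toℕ i ≡ N ∸ 1) × (toℕ j ≡ 0))

CycleAdj : (N : ℕ) → Fin N → Fin N → Set
CycleAdj N i j = CycleSucc N i j ⊎ CycleSucc N j i

{-# OPTIONS --safe #-}
-- Orient the edges of C_N as i → i + 1 (mod N). This relation is functional and injective, so an
-- injective walk in its symmetric closure cannot turn around: a path runs entirely forwards or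
-- entirely backwards, and its endpoints differ by ±t modulo N. Hence i ↦ i mod g is t-periodic
-- whenever g divides t and N, which gives gcd t N colours. Conversely, for t < N the arcs
-- x, x + 1, …, x + t are paths, so a t-periodic colouring, read as a function of x ∈ ℕ, has
-- periods t and N, hence by Bézout period gcd t N, and it factors through the residues mod gcd t N.
module Submission where

open import Defs
open import Data.Nat using (ℕ; _≤_; zero; suc; _+_; _*_; _∸_; _<_; _%_; _/_; NonZero; ≢-nonZero)
open import Data.Nat.GCD using (gcd; gcd[m,n]∣m; gcd[m,n]∣n; gcd[m,n]≢0; gcd-GCD; module Bézout)
open import Data.Product using (_×_; _,_; proj₁; proj₂)
open import Data.Nat.Properties
open import Data.Nat.DivMod
open import Data.Nat.Divisibility using (_∣_; divides; ∣-refl; ∣⇒≤)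
open import Data.Fin as F using (Fin; toℕ; inject₁; fromℕ; fromℕ<)
open import Data.Fin.Properties as Finₚ using (toℕ-injective; toℕ<n; toℕ-fromℕ<; toℕ-fromℕ; fromℕ<-cong; toℕ-inject₁; injective⇒≤)
open import Data.Sum using (_⊎_; inj₁; inj₂)
open import Function.Base using (_∘_; flip)
open import Function.Definitions using (Injective; Surjective)
open import Relation.Binary.PropositionalEquality

open ≡-Reasoning

+-congˡ-% : ∀ c {a b n} .{{_ : NonZero n}} → a % n ≡ b % n → (c + a) % n ≡ (c + b) % n
+-congˡ-% c {a} {b} {n} eq = begin
  (c + a) % n             ≡⟨ %-distribˡ-+ c a n ⟩
  (c % n + a % n) % n     ≡⟨ cong (λ z → (c % n + z) % n) eq ⟩
  (c % n + b % n) % n     ≡⟨ %-distribˡ-+ c b n ⟨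
  (c + b) % n             ∎

+-%-injectiveʳ : ∀ x {i j n} .{{_ : NonZero n}} → i < n → j < n →
                 (x + i) % n ≡ (x + j) % n → i ≡ j
+-%-injectiveʳ x {i} {j} {n} i<n j<n eq = begin
  i                       ≡⟨ m<n⇒m%n≡m i<n ⟨
  i % n                   ≡⟨ cancel i ⟨
  (y + (x + i)) % n       ≡⟨ +-congˡ-% y eq ⟩
  (y + (x + j)) % n       ≡⟨ cancel j ⟩
  j % n                   ≡⟨ m<n⇒m%n≡m j<n ⟩
  j                       ∎
  where
  -- y is an additive inverse of x modulo n
  y : ℕ
  y = n ∸ x % n
  n∣y+x : n ∣ y + x
  n∣y+x = divides (suc (x / n)) (begin
    y + x                   ≡⟨ cong (y +_) (m≡m%n+[m/n]*n x n) ⟩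
    y + (x % n + x / n * n) ≡⟨ +-assoc y (x % n) (x / n * n) ⟨
    y + x % n + x / n * n   ≡⟨ cong (_+ x / n * n) (trans (+-comm y (x % n)) (m+[n∸m]≡n (m%n≤n x n))) ⟩
    n + x / n * n           ∎)
  cancel : ∀ m → (y + (x + m)) % n ≡ m % n
  cancel m = trans (cong (_% n) (sym (+-assoc y x m))) (%-remove-+ˡ m n∣y+x)

%-cong-∣ : ∀ {m n a b} .{{_ : NonZero m}} .{{_ : NonZero n}} → m ∣ n →
           a % n ≡ b % n → a % m ≡ b % m
%-cong-∣ {m} {n} {a} {b} m∣n eq = begin
  a % m        ≡⟨ m∣n⇒o%n%m≡o%m m n a m∣n ⟨
  a % n % m    ≡⟨ cong (_% m) eq ⟩
  b % n % m    ≡⟨ m∣n⇒o%n%m≡o%m m n b m∣n ⟩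
  b % m        ∎

toℕ-mod : ∀ m n .{{_ : NonZero n}} → toℕ (m mod n) ≡ m % n
toℕ-mod m n = toℕ-fromℕ< (m%n<n m n)

mod-cong : ∀ m o {n} .{{_ : NonZero n}} → m % n ≡ o % n → m mod n ≡ o mod n
mod-cong m o eq = fromℕ<-cong _ _ eq _ _

mod-toℕ : ∀ {n} .{{_ : NonZero n}} (i : Fin n) → toℕ i mod n ≡ i
mod-toℕ {n} i = toℕ-injective (trans (toℕ-mod (toℕ i) n) (m<n⇒m%n≡m (toℕ<n i)))

surjective⇒≥ : ∀ {m n} {f : Fin m → Fin n} → Surjective _≡_ _≡_ f → n ≤ m
surjective⇒≥ {m} {n} {f} surj = injective⇒≤ {f = section} section-injective
  where
  section : Fin n → Fin m
  section = proj₁ ∘ surj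
  f∘section : ∀ y → f (section y) ≡ y
  f∘section y = proj₂ (surj y) refl
  section-injective : Injective _≡_ _≡_ section
  section-injective {y} {z} eq = trans (sym (f∘section y)) (trans (cong f eq) (f∘section z))

module _ (n : ℕ) .{{_ : NonZero n}} where

  telescope-suc : ∀ t (s : Fin (suc t) → ℕ) →
                  (∀ j → s (F.suc j) % n ≡ suc (s (inject₁ j)) % n) →
                  s (fromℕ t) % n ≡ (t + s F.zero) % n
  telescope-suc zero    s step = refl
  telescope-suc (suc t) s step = begin
    s (fromℕ (suc t)) % n        ≡⟨ telescope-suc t (s ∘ F.suc) (step ∘ F.suc) ⟩
    (t + s (F.suc F.zero)) % n   ≡⟨ +-congˡ-% t (step F.zero) ⟩
    (t + suc (s F.zero)) % n     ≡⟨ cong (_% n) (+-suc t (s F.zero)) ⟩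
    (suc t + s F.zero) % n       ∎

  telescope-pred : ∀ t (s : Fin (suc t) → ℕ) →
                   (∀ j → s (inject₁ j) % n ≡ suc (s (F.suc j)) % n) →
                   s F.zero % n ≡ (t + s (fromℕ t)) % n
  telescope-pred zero    s step = refl
  telescope-pred (suc t) s step = begin
    s F.zero % n                      ≡⟨ step F.zero ⟩
    suc (s (F.suc F.zero)) % n        ≡⟨ +-congˡ-% 1 (telescope-pred t (s ∘ F.suc) (step ∘ F.suc)) ⟩
    (suc t + s (fromℕ (suc t))) % n   ∎

HasPeriod : {A : Set} → (ℕ → A) → ℕ → Set
HasPeriod f p = ∀ n → f (n + p) ≡ f n

module _ {A : Set} {f : ℕ → A} where

  period-* : ∀ {p} → HasPeriod f p → ∀ m → HasPeriod f (m * p)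
  period-* per zero    n = cong f (+-identityʳ n)
  period-* {p} per (suc m) n = begin
    f (n + (p + m * p))   ≡⟨ cong f (+-assoc n p (m * p)) ⟨
    f (n + p + m * p)     ≡⟨ period-* per m (n + p) ⟩
    f (n + p)             ≡⟨ per n ⟩
    f n                   ∎

  period-gcd : ∀ {a b} → HasPeriod f a → HasPeriod f b → HasPeriod f (gcd a b)
  period-gcd {a} {b} per-a per-b n with Bézout.identity (gcd-GCD a b)
  ... | Bézout.+- x y eq = begin
    f (n + d)             ≡⟨ period-* per-b y (n + d) ⟨
    f (n + d + y * b)     ≡⟨ cong f (trans (+-assoc n d (y * b)) (cong (n +_) eq)) ⟩
    f (n + x * a)         ≡⟨ period-* per-a x n ⟩
    f n                   ∎
    where
    d : ℕ
    d = gcd a b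
  ... | Bézout.-+ x y eq = begin
    f (n + d)             ≡⟨ period-* per-a x (n + d) ⟨
    f (n + d + x * a)     ≡⟨ cong f (trans (+-assoc n d (x * a)) (cong (n +_) eq)) ⟩
    f (n + y * b)         ≡⟨ period-* per-b y n ⟩
    f n                   ∎
    where
    d : ℕ
    d = gcd a b

  period-% : ∀ {p} .{{_ : NonZero p}} → HasPeriod f p → ∀ n → f (n % p) ≡ f n
  period-% {p} per n = begin
    f (n % p)             ≡⟨ period-* per (n / p) (n % p) ⟨
    f (n % p + n / p * p) ≡⟨ cong f (m≡m%n+[m/n]*n n p) ⟨
    f n                   ∎

Walk : {V : Set} → (V → V → Set) → ∀ {t} → (Fin (suc t) → V) → Set
Walk R {t} v = (j : Fin t) → R (v (inject₁ j)) (v (F.suc j))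

module _ {V : Set} {R : V → V → Set}
         (R-functional : ∀ {a b c} → R a b → R a c → b ≡ c)
         (R-injective : ∀ {a b c} → R a c → R b c → a ≡ b) where

  injective-walk-monotone : ∀ t (v : Fin (suc t) → V) → Injective _≡_ _≡_ v →
    ((j : Fin t) → R (v (inject₁ j)) (v (F.suc j)) ⊎ R (v (F.suc j)) (v (inject₁ j))) →
    Walk R v ⊎ Walk (flip R) v
  injective-walk-monotone zero v _ _ = inj₁ λ ()
  injective-walk-monotone (suc zero) v _ step with step F.zero
  ... | inj₁ r = inj₁ λ { F.zero → r }
  ... | inj₂ r = inj₂ λ { F.zero → r }
  injective-walk-monotone (suc (suc t)) v v-inj step
    with injective-walk-monotone (suc t) (v ∘ F.suc) (Finₚ.suc-injective ∘ v-inj) (step ∘ F.suc)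
       | step F.zero
  ... | inj₁ rest | inj₁ r = inj₁ λ { F.zero → r ; (F.suc j) → rest j }
  ... | inj₂ rest | inj₂ r = inj₂ λ { F.zero → r ; (F.suc j) → rest j }
  ... | inj₁ rest | inj₂ r with v-inj (R-functional r (rest F.zero))
  ...   | ()
  injective-walk-monotone (suc (suc t)) v v-inj step | inj₂ rest | inj₁ r
    with v-inj (R-injective r (rest F.zero))
  ... | ()

module Cycle {n : ℕ} where

  N : ℕ
  N = suc n

  cycleSucc⇒ : ∀ {a b : Fin N} → CycleSucc N a b → toℕ b % N ≡ suc (toℕ a) % N
  cycleSucc⇒ (inj₁ b≡1+a) = cong (_% N) b≡1+a
  cycleSucc⇒ {a} {b} (inj₂ (a≡n , b≡0)) = begin
    toℕ b % N        ≡⟨ cong (_% N) b≡0 ⟩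
    0                ≡⟨ n%n≡0 N ⟨
    N % N            ≡⟨ cong (λ z → suc z % N) a≡n ⟨
    suc (toℕ a) % N  ∎

  ⇒cycleSucc : ∀ {a b : Fin N} → toℕ b % N ≡ suc (toℕ a) % N → CycleSucc N a b
  ⇒cycleSucc {a} {b} eq with m≤n⇒m<n∨m≡n (toℕ<n a)
  ... | inj₁ 1+a<N = inj₁ (begin
    toℕ b            ≡⟨ m<n⇒m%n≡m (toℕ<n b) ⟨
    toℕ b % N        ≡⟨ eq ⟩
    suc (toℕ a) % N  ≡⟨ m<n⇒m%n≡m 1+a<N ⟩
    suc (toℕ a)      ∎)
  ... | inj₂ 1+a≡N = inj₂ (suc-injective 1+a≡N , (begin
    toℕ b            ≡⟨ m<n⇒m%n≡m (toℕ<n b) ⟨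
    toℕ b % N        ≡⟨ eq ⟩
    suc (toℕ a) % N  ≡⟨ cong (_% N) 1+a≡N ⟩
    N % N            ≡⟨ n%n≡0 N ⟩
    0                ∎))

  cycleSucc-functional : ∀ {a b c : Fin N} → CycleSucc N a b → CycleSucc N a c → b ≡ c
  cycleSucc-functional {b = b} {c} ab ac =
    toℕ-injective (+-%-injectiveʳ 0 (toℕ<n b) (toℕ<n c) (trans (cycleSucc⇒ ab) (sym (cycleSucc⇒ ac))))

  cycleSucc-injective : ∀ {a b c : Fin N} → CycleSucc N a c → CycleSucc N b c → a ≡ b
  cycleSucc-injective {a} {b} ac bc =
    toℕ-injective (+-%-injectiveʳ 1 (toℕ<n a) (toℕ<n b) (trans (sym (cycleSucc⇒ ac)) (cycleSucc⇒ bc)))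

  cycleSucc-mod : ∀ m → CycleSucc N (m mod N) (suc m mod N)
  cycleSucc-mod m = ⇒cycleSucc (begin
    toℕ (suc m mod N) % N    ≡⟨ cong (_% N) (toℕ-mod (suc m) N) ⟩
    suc m % N % N            ≡⟨ m%n%n≡m%n (suc m) N ⟩
    suc m % N                ≡⟨ +-congˡ-% 1 {m} {m % N} (sym (m%n%n≡m%n m N)) ⟩
    suc (m % N) % N          ≡⟨ cong (λ z → suc z % N) (toℕ-mod m N) ⟨
    suc (toℕ (m mod N)) % N  ∎)

  path-ends : ∀ {t} (p : Path (CycleAdj N) t) →
              toℕ (end p) % N ≡ (t + toℕ (start p)) % N
              ⊎ toℕ (start p) % N ≡ (t + toℕ (end p)) % N
  path-ends {t} p
    with injective-walk-monotone {R = CycleSucc N} cycleSucc-functional cycleSucc-injective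
           t (vtx p) (distinct p) (adjacent p)
  ... | inj₁ forward  = inj₁ (telescope-suc N t (toℕ ∘ vtx p) (cycleSucc⇒ ∘ forward))
  ... | inj₂ backward = inj₂ (telescope-pred N t (toℕ ∘ vtx p) (cycleSucc⇒ ∘ backward))

  arc : ∀ x t → t < N → Path (CycleAdj N) t
  arc x t t<N = record { vtx = v ; distinct = v-injective ; adjacent = v-adjacent }
    where
    v : Fin (suc t) → Fin N
    v j = (x + toℕ j) mod N
    v-injective : Injective _≡_ _≡_ v
    v-injective {i} {j} vi≡vj = toℕ-injective (+-%-injectiveʳ x
      (<-≤-trans (toℕ<n i) t<N) (<-≤-trans (toℕ<n j) t<N)
      (trans (sym (toℕ-mod (x + toℕ i) N)) (trans (cong toℕ vi≡vj) (toℕ-mod (x + toℕ j) N))))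
    v-adjacent : (j : Fin t) → CycleAdj N (v (inject₁ j)) (v (F.suc j))
    v-adjacent j = inj₁ (subst₂ (CycleSucc N)
      (cong (λ z → (x + z) mod N) (sym (toℕ-inject₁ j)))
      (cong (_mod N) (sym (+-suc x (toℕ j))))
      (cycleSucc-mod (x + toℕ j)))

  residue-colouring : ∀ {t g} .{{_ : NonZero g}} → g ∣ N → g ∣ t →
                      HasPeriodicColouring (CycleAdj N) t g
  residue-colouring {t} {g} g∣N g∣t = colour , colour-surjective , colour-periodic
    where
    colour : Fin N → Fin g
    colour i = toℕ i mod g
    colour-surjective : Surjective _≡_ _≡_ colour
    colour-surjective y = fromℕ< (<-≤-trans (toℕ<n y) (∣⇒≤ g∣N)) ,
      λ { refl → trans (cong (_mod g) (toℕ-fromℕ< _)) (mod-toℕ y) }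
    colour-periodic : Periodic (CycleAdj N) t colour
    colour-periodic p with path-ends p
    ... | inj₁ eq = mod-cong _ _ (sym (trans (%-cong-∣ g∣N eq) (%-remove-+ˡ _ g∣t)))
    ... | inj₂ eq = mod-cong _ _ (trans (%-cong-∣ g∣N eq) (%-remove-+ˡ _ g∣t))

  periodic-colouring-bound : ∀ {t k} → t ≤ N → .{{_ : NonZero (gcd t N)}} →
                             HasPeriodicColouring (CycleAdj N) t k → k ≤ gcd t N
  periodic-colouring-bound {t} {k} t≤N (c , c-surjective , c-periodic) =
    surjective⇒≥ {f = d} d-surjective
    where
    g : ℕ
    g = gcd t N
    C : ℕ → Fin k
    C m = c (m mod N)
    C-period-N : HasPeriod C N
    C-period-N m = cong c (mod-cong (m + N) m (%-remove-+ʳ m ∣-refl))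
    C-period-t : HasPeriod C t
    C-period-t m with m≤n⇒m<n∨m≡n t≤N
    ... | inj₂ refl = C-period-N m
    ... | inj₁ t<N = begin
      C (m + t)                 ≡⟨ cong (λ z → c ((m + z) mod N)) (toℕ-fromℕ t) ⟨
      c (end (arc m t t<N))     ≡⟨ c-periodic (arc m t t<N) ⟨
      c (start (arc m t t<N))   ≡⟨ cong C (+-identityʳ m) ⟩
      C m                       ∎
    d : Fin g → Fin k
    d y = C (toℕ y)
    d-residue : ∀ i → d (toℕ i mod g) ≡ c i
    d-residue i = begin
      C (toℕ (toℕ i mod g))     ≡⟨ cong C (toℕ-mod (toℕ i) g) ⟩
      C (toℕ i % g)             ≡⟨ period-% (period-gcd C-period-t C-period-N) (toℕ i) ⟩
      C (toℕ i)                 ≡⟨ cong c (mod-toℕ i) ⟩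
      c i                       ∎
    d-surjective : Surjective _≡_ _≡_ d
    d-surjective z = toℕ x mod g , λ { refl → trans (d-residue x) (proj₂ (c-surjective z) refl) }
      where x = proj₁ (c-surjective z)

theorem4p5 : (N t : ℕ) → 3 ≤ N → 1 ≤ t → t ≤ N →
    HasPeriodicColouring (CycleAdj N) t (gcd t N)
    × ((k : ℕ) → HasPeriodicColouring (CycleAdj N) t k → k ≤ gcd t N)
theorem4p5 N@(suc _) t _ _ t≤N =
    Cycle.residue-colouring (gcd[m,n]∣n t N) (gcd[m,n]∣m t N)
  , λ k → Cycle.periodic-colouring-bound t≤N
  where
  instance
    gcd≢0 : NonZero (gcd t N)
    gcd≢0 = ≢-nonZero (gcd[m,n]≢0 t N (inj₂ λ ()))
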